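{- Let $G$ be a finite abelian group of order $n$ such that the generalized dihedral group $D(G)$ is non-abelian. Then the chromatic number of the commuting graph $\Gamma=\mathfrak{C}(D(G),D(G))$ is $n$.
   Context: $D(G)=G\rtimes C_2$, $C_2=\{1,-1\}$, has elements $(g,c)$ with multiplication $(g_1,c_1)(g_2,c_2)=(g_1g_2^{c_1},c_1c_2)$. The commuting graph $\mathfrak{C}(D(G),D(G))$ is the simple graph with vertex set $D(G)$ in which distinct $u,v$ are adjacent iff $uv=vu$. The chromatic number is the least number of colors in a proper vertex coloring. -}

module Defs where

open import Level using (0ℓ)
open import Data.Nat using (ℕ; _≤_)
open import Data.Fin using (Fin)
open import Data.Bool using (Bool; true; false; not)
open import Data.Product using (_×_; _,_; Σ)
open import Relation.Nullary using (¬_)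
open import Relation.Binary.PropositionalEquality using (_≡_; _≢_)
open import Algebra.Structures using (IsAbelianGroup)

record FinAbGroup (n : ℕ) : Set where
  field
    _∙_ : Fin n → Fin n → Fin n
    ε   : Fin n
    _⁻¹ : Fin n → Fin n
    isAbelianGroup : IsAbelianGroup _≡_ _∙_ ε _⁻¹

module _ {n : ℕ} (G : FinAbGroup n) where
  open FinAbGroup G

  -- C₂ = {1,-1} encoded as Bool: true = 1, false = -1;
  -- multiplication in C₂ (1·c=c, (-1)·c = -c).
  _·C_ : Bool → Bool → Bool
  true  ·C c = c
  false ·C c = not c

  D : Set
  D = Fin n × Bool

  pow : Fin n → Bool → Fin n
  pow g true  = g
  pow g false = g ⁻¹

  _·D_ : D → D → D
  (g₁ , c₁) ·D (g₂ , c₂) = (g₁ ∙ pow g₂ c₁) , (c₁ ·C c₂)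

  DNonAbelian : Set
  DNonAbelian = ¬ (∀ (u v : D) → u ·D v ≡ v ·D u)

  Adj : D → D → Set
  Adj u v = u ≢ v × u ·D v ≡ v ·D u

  ProperColoring : (k : ℕ) → (D → Fin k) → Set
  ProperColoring k f = ∀ u v → Adj u v → f u ≢ f v

  Colorable : ℕ → Set
  Colorable k = Σ (D → Fin k) (ProperColoring k)

  ChromaticNumberIs : ℕ → Set
  ChromaticNumberIs χ = Colorable χ × (∀ k → Colorable k → χ ≤ k)

module Submission where

-- Write rotations (g , 1) and reflections (g , -1) of D(G) = G ⋊ C₂, and
-- call x an involution when x² = ε.  In an abelian group squaring is an
-- endomorphism, and the commutation relations of D(G) read:
--   * any two rotations commute, so the n rotations form a clique;
--   * a rotation (h , 1) commuting with a reflection forces h² = ε;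
--   * reflections (g , -1), (h , -1) commuting forces g² = h².
-- The clique gives the lower bound n.  For the upper bound, D(G) is
-- non-abelian exactly when G has an element a with a² ≠ ε; colour
-- (g , 1) by g and (g , -1) by g if g² ≠ ε and by a·g otherwise.
-- Reflection colours are never involutions, so they avoid the colours of
-- the rotations adjacent to them, and two commuting reflections have equal
-- squares, so they receive distinct colours.

open import Defs
open import Level using (0ℓ)
open import Data.Nat using (ℕ; _≤_)
open import Data.Fin using (Fin; _≟_)
open import Data.Fin.Properties using (injective⇒≤; ¬∀⟶∃¬)
open import Data.Bool using (true; false)
open import Data.Product using (_,_; ∃; proj₁; proj₂)
open import Function using (_∘_)
open import Data.Empty using (⊥-elim)
open import Relation.Nullary using (Dec; yes; no)
open import Relation.Nullary.Decidable using (decidable-stable)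
open import Relation.Binary.PropositionalEquality
  using (_≡_; _≢_; refl; sym; trans; cong; cong₂; module ≡-Reasoning)
open import Algebra.Bundles using (AbelianGroup)

module Squares {c ℓ} (𝒢 : AbelianGroup c ℓ) where
  open AbelianGroup 𝒢
  open import Relation.Binary.Reasoning.Setoid setoid
  open import Algebra.Properties.CommutativeSemigroup commutativeSemigroup
    using (interchange)
  open import Algebra.Properties.Group group using (inverseˡ-unique)

  square : Carrier → Carrier
  square x = x ∙ x

  square-∙ : ∀ x y → square (x ∙ y) ≈ square x ∙ square y
  square-∙ x y = interchange x y x y

  square-∙-involution : ∀ x y → square y ≈ ε → square (x ∙ y) ≈ square x
  square-∙-involution x y y²≈ε = begin
    square (x ∙ y)         ≈⟨ square-∙ x y ⟩
    square x ∙ square y    ≈⟨ ∙-congˡ y²≈ε ⟩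
    square x ∙ ε           ≈⟨ identityʳ (square x) ⟩
    square x               ∎

  involution⇒self-inverse : ∀ x → square x ≈ ε → x ≈ x ⁻¹
  involution⇒self-inverse x = inverseˡ-unique x x

  balanced⇒same-square : ∀ x y → x ∙ y ⁻¹ ≈ y ∙ x ⁻¹ → square x ≈ square y
  balanced⇒same-square x y balanced = begin
    square x                  ≈⟨ identityʳ (square x) ⟨
    square x ∙ ε              ≈⟨ ∙-congˡ (inverseˡ y) ⟨
    (x ∙ x) ∙ (y ⁻¹ ∙ y)      ≈⟨ interchange x x (y ⁻¹) y ⟩
    (x ∙ y ⁻¹) ∙ (x ∙ y)      ≈⟨ ∙-cong balanced (comm x y) ⟩
    (y ∙ x ⁻¹) ∙ (y ∙ x)      ≈⟨ interchange y (x ⁻¹) y x ⟩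
    (y ∙ y) ∙ (x ⁻¹ ∙ x)      ≈⟨ ∙-congˡ (inverseˡ x) ⟩
    square y ∙ ε              ≈⟨ identityʳ (square y) ⟩
    square y                  ∎

pattern rotation g   = g , true
pattern reflection g = g , false

module CommutingGraph {n : ℕ} (G : FinAbGroup n) where
  𝒢 : AbelianGroup 0ℓ 0ℓ
  𝒢 = record { isAbelianGroup = FinAbGroup.isAbelianGroup G }

  open AbelianGroup 𝒢 using (_∙_; ε; _⁻¹; comm; inverseʳ)
  open import Algebra.Properties.Group (AbelianGroup.group 𝒢) using (∙-cancelˡ)
  open Squares 𝒢 public
  open ≡-Reasoning

  ·C-comm : ∀ c d → _·C_ G c d ≡ _·C_ G d c
  ·C-comm true  true  = refl
  ·C-comm true  false = refl
  ·C-comm false true  = refl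
  ·C-comm false false = refl

  rotations-commute : ∀ g h →
    _·D_ G (rotation g) (rotation h) ≡ _·D_ G (rotation h) (rotation g)
  rotations-commute g h = cong (_, true) (comm g h)

  -- A rotation commuting with a reflection is an involution:
  -- (h , 1)(g , -1) = (hg , -1) while (g , -1)(h , 1) = (gh⁻¹ , -1).
  rotation-reflection-commute : ∀ h g →
    _·D_ G (rotation h) (reflection g) ≡ _·D_ G (reflection g) (rotation h) →
    square h ≡ ε
  rotation-reflection-commute h g commute = begin
    h ∙ h      ≡⟨ cong (h ∙_) h≡h⁻¹ ⟩
    h ∙ h ⁻¹   ≡⟨ inverseʳ h ⟩
    ε          ∎
    where
    h≡h⁻¹ : h ≡ h ⁻¹
    h≡h⁻¹ = ∙-cancelˡ g h (h ⁻¹) (trans (comm g h) (cong proj₁ commute))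

  -- Commuting reflections have equal squares:
  -- (g , -1)(h , -1) = (gh⁻¹ , 1) while (h , -1)(g , -1) = (hg⁻¹ , 1).
  reflections-commute : ∀ g h →
    _·D_ G (reflection g) (reflection h) ≡ _·D_ G (reflection h) (reflection g) →
    square g ≡ square h
  reflections-commute g h commute = balanced⇒same-square g h (cong proj₁ commute)

  -- If every element of G is an involution, then g^c = g and D(G) is abelian.
  all-involutions⇒abelian : (∀ x → square x ≡ ε) → ∀ u v → _·D_ G u v ≡ _·D_ G v u
  all-involutions⇒abelian involution (g , c) (h , d) =
    cong₂ _,_ (begin
      g ∙ pow G h c    ≡⟨ cong (g ∙_) (pow-trivial h c) ⟩
      g ∙ h            ≡⟨ comm g h ⟩
      h ∙ g            ≡⟨ cong (h ∙_) (pow-trivial g d) ⟨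
      h ∙ pow G g d    ∎)
      (·C-comm c d)
    where
    pow-trivial : ∀ x c → pow G x c ≡ x
    pow-trivial x true  = refl
    pow-trivial x false = sym (involution⇒self-inverse x (involution x))

  non-involution : DNonAbelian G → ∃ λ a → square a ≢ ε
  non-involution nonAbelian =
    ¬∀⟶∃¬ n (λ x → square x ≡ ε) (λ x → square x ≟ ε)
      (nonAbelian ∘ all-involutions⇒abelian)

  rotations-clique : ∀ g h → g ≢ h → Adj G (rotation g) (rotation h)
  rotations-clique g h g≢h = g≢h ∘ cong proj₁ , rotations-commute g h

  clique-bound : ∀ {m k} (ι : Fin m → D G) →
    (∀ x y → x ≢ y → Adj G (ι x) (ι y)) → Colorable G k → m ≤ k
  clique-bound ι clique (f , proper) = injective⇒≤ {f = f ∘ ι} injective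
    where
    injective : ∀ {x y} → f (ι x) ≡ f (ι y) → x ≡ y
    injective {x} {y} same =
      decidable-stable (x ≟ y) (λ x≢y → proper (ι x) (ι y) (clique x y x≢y) same)

  module Colouring (a : Fin n) (a²≢ε : square a ≢ ε) where

    -- Involutions are moved off the involutions by multiplying with a.
    shift : (g : Fin n) → Dec (square g ≡ ε) → Fin n
    shift g (yes _) = a ∙ g
    shift g (no  _) = g

    colour : D G → Fin n
    colour (rotation g)   = g
    colour (reflection g) = shift g (square g ≟ ε)

    shift-non-involution : ∀ g d → square (shift g d) ≢ ε
    shift-non-involution g (yes g²≡ε) = a²≢ε ∘ trans (sym (square-∙-involution a g g²≡ε))
    shift-non-involution g (no  g²≢ε) = g²≢ε

    shift-injective : ∀ g h → square g ≡ square h → ∀ dg dh →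
      shift g dg ≡ shift h dh → g ≡ h
    shift-injective g h _     (yes _)    (yes _)    same = ∙-cancelˡ a g h same
    shift-injective g h g²≡h² (yes g²≡ε) (no  h²≢ε) _    =
      ⊥-elim (h²≢ε (trans (sym g²≡h²) g²≡ε))
    shift-injective g h g²≡h² (no  g²≢ε) (yes h²≡ε) _    =
      ⊥-elim (g²≢ε (trans g²≡h² h²≡ε))
    shift-injective g h _     (no  _)    (no  _)    same = same

    rotation-reflection-proper : ∀ h g →
      Adj G (rotation h) (reflection g) → h ≢ colour (reflection g)
    rotation-reflection-proper h g (_ , commute) h≡colour =
      shift-non-involution g (square g ≟ ε)
        (trans (cong square (sym h≡colour)) (rotation-reflection-commute h g commute))

    proper : ProperColoring G n colour
    proper (rotation g)   (rotation h)   (g≢h , _) same = g≢h (cong rotation same)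
    proper (rotation h)   (reflection g) adjacent  same =
      rotation-reflection-proper h g adjacent same
    proper (reflection g) (rotation h)   (g≢h , commute) same =
      rotation-reflection-proper h g (g≢h ∘ sym , sym commute) (sym same)
    proper (reflection g) (reflection h) (g≢h , commute) same =
      g≢h (cong reflection (shift-injective g h (reflections-commute g h commute)
                                            (square g ≟ ε) (square h ≟ ε) same))

proposition2p5 : (n : ℕ) (G : FinAbGroup n) → DNonAbelian G → ChromaticNumberIs G n
proposition2p5 n G nonAbelian =
  (colour , proper) , λ k → clique-bound rotation rotations-clique
  where
  open CommutingGraph G
  open Colouring (proj₁ (non-involution nonAbelian)) (proj₂ (non-involution nonAbelian))
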